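{- Let $n\ge 2$, let $d\in\mathbb{R}^{\binom{n}{2}}$, and run the UPGMA algorithm on $d$ (ties broken arbitrarily), producing the output vector $x$ and the maximal chain of partitions $\mathcal{F}$ given by the successive partitions formed by the algorithm. Then $x$ is the orthogonal (Euclidean nearest-point) projection of $d$ onto the cone $C_{\mathcal{F}}$.
   Context: Coordinates of $\mathbb{R}^{\binom{n}{2}}$ are indexed by unordered pairs $\{i,j\}$ of distinct elements of $[n]=\{1,\dots,n\}$, with the standard inner product. A maximal chain of partitions $\mathcal{F}$ is a sequence $\pi_0,\pi_1,\dots,\pi_{n-1}$ of set partitions of $[n]$, where $\pi_0$ consists of singletons and $\pi_k$ is obtained from $\pi_{k-1}$ by merging two blocks $S_k,T_k$ into $S_k\cup T_k$ (so $\pi_{n-1}=\{[n]\}$). Set $D_k=\{\{i,j\}: i\in S_k,\ j\in T_k\}$ for $k=1,\dots,n-1$; these sets partition the set of all pairs. Define $C_{\mathcal{F}}=\{x\in\mathbb{R}^{\binom{n}{2}}: x \text{ is constant on each } D_k \text{ with value } c_k,\ c_1\le c_2\le\cdots\le c_{n-1}\}$, a closed convex polyhedral cone. UPGMA algorithm: start with the partition of $[n]$ into singletons. While there is more than one block: among all pairs of distinct current blocks $S,T$, choose one minimizing $\frac{1}{|S||T|}\sum_{i\in S,\,j\in T} d(i,j)$; set $x(i,j)$ equal to this minimal average for all $i\in S$, $j\in T$; replace $S,T$ by $S\cup T$. The sequence of partitions produced is a maximal chain of partitions $\mathcal{F}$, and $x$ is the output. -}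

module Defs where

open import Level using (0ℓ)
open import Data.Nat as ℕ using (ℕ; zero; suc)
open import Data.Bool using (Bool; true; false; if_then_else_)
open import Data.Fin using (Fin; toℕ)
open import Data.Fin.Subset using (Subset; ∣_∣; _∈_; _∪_; ⁅_⁆)
open import Data.Vec using (lookup)
open import Data.List using (List; []; _∷_; map; allFin)
open import Data.List.Relation.Binary.Permutation.Propositional using (_↭_)
open import Data.List.Relation.Binary.Pointwise using (Pointwise)
open import Data.List.Relation.Unary.All using (All)
open import Data.List.Relation.Unary.Linked using (Linked)
open import Data.Product using (_×_; _,_; ∃-syntax)
open import Relation.Binary.PropositionalEquality using (_≡_)
open import Relation.Nullary using (¬_)
open import Algebra.Structures using (IsCommutativeRing)
open import Relation.Binary.Structures using (IsTotalOrder)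

-- Ordered fields (stdlib has no reals; the statement is proved for an
-- arbitrary ordered field, of which ℝ is an instance).

record OrderedField : Set₁ where
  infixl 7 _*_
  infixl 6 _+_ _-_
  infix 4 _≤_
  field
    Carrier : Set
    _+_ _*_ : Carrier → Carrier → Carrier
    -_ : Carrier → Carrier
    0# 1# : Carrier
    _⁻¹ : Carrier → Carrier          -- total; value at 0# is irrelevant
    _≤_ : Carrier → Carrier → Set
    isCommutativeRing : IsCommutativeRing _≡_ _+_ _*_ -_ 0# 1#
    0≢1 : ¬ (0# ≡ 1#)
    ⁻¹-inverse : ∀ x → ¬ (x ≡ 0#) → x * (x ⁻¹) ≡ 1#
    isTotalOrder : IsTotalOrder _≡_ _≤_
    +-mono-≤ : ∀ x y z → x ≤ y → x + z ≤ y + z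
    *-nonneg : ∀ x y → 0# ≤ x → 0# ≤ y → 0# ≤ x * y

  _-_ : Carrier → Carrier → Carrier
  x - y = x + (- y)

module UPGMA (F : OrderedField) where
  open OrderedField F

  fromℕ : ℕ → Carrier
  fromℕ zero    = 0#
  fromℕ (suc k) = 1# + fromℕ k

  sumFin : ∀ {n} → (Fin n → Carrier) → Carrier
  sumFin {zero}  f = 0#
  sumFin {suc n} f = f Fin.zero + sumFin (λ i → f (Fin.suc i))

  -- a "dissimilarity vector" in ℝ^(n choose 2): the value at the pair {i,j}
  -- (i ≠ j) is read off from the entries (i,j) / (j,i); the diagonal is unused.
  Vect : ℕ → Set
  Vect n = Fin n → Fin n → Carrier

  Symmetric : ∀ {n} → Vect n → Set
  Symmetric d = ∀ i j → d i j ≡ d j i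

  avg : ∀ {n} → Vect n → Subset n → Subset n → Carrier
  avg d S T =
    sumFin (λ i → sumFin (λ j →
      if lookup S i then (if lookup T j then d i j else 0#) else 0#))
    * (fromℕ (∣ S ∣ ℕ.* ∣ T ∣)) ⁻¹

  dist² : ∀ {n} → Vect n → Vect n → Carrier
  dist² d y = sumFin (λ i → sumFin (λ j →
      if toℕ i ℕ.<ᵇ toℕ j then (d i j - y i j) * (d i j - y i j) else 0#))

  singletons : ∀ n → List (Subset n)
  singletons n = map ⁅_⁆ (allFin n)

  Step : ∀ {n} → Vect n → List (Subset n) → Subset n → Subset n → List (Subset n) → Set
  Step d P S T Q =
    (P ↭ (S ∷ T ∷ Q)) ×
    (∀ S' T' Q' → P ↭ (S' ∷ T' ∷ Q') → avg d S T ≤ avg d S' T')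

  -- a merge record: the merged blocks S_k, T_k and the value assigned
  Merge : ℕ → Set
  Merge n = Subset n × Subset n × Carrier

  -- Run d P ms : running UPGMA on d from partition P (ties broken
  -- arbitrarily) performs the merges ms, in order, until one block remains.
  data Run {n} (d : Vect n) : List (Subset n) → List (Merge n) → Set where
    done : ∀ S → Run d (S ∷ []) []
    step : ∀ {P S T Q ms} → Step d P S T Q → Run d ((S ∪ T) ∷ Q) ms →
           Run d P ((S , T , avg d S T) ∷ ms)

  -- the maximal chain of partitions, recorded as its merges (S_k, T_k)
  chain : ∀ {n} → List (Merge n) → List (Subset n × Subset n)
  chain = map (λ { (S , T , _) → (S , T) })

  IsOutput : ∀ {n} → List (Merge n) → Vect n → Set
  IsOutput ms x = All (λ { (S , T , a) →
    ∀ i j → i ∈ S → j ∈ T → (x i j ≡ a) × (x j i ≡ a) }) ms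

  ConstOn : ∀ {n} → Vect n → Subset n × Subset n → Carrier → Set
  ConstOn y (S , T) c = ∀ i j → i ∈ S → j ∈ T → (y i j ≡ c) × (y j i ≡ c)

  InCone : ∀ {n} → List (Subset n × Subset n) → Vect n → Set
  InCone 𝓕 y = ∃[ cs ] (Pointwise (ConstOn y) 𝓕 cs × Linked _≤_ cs)

  IsNearestPoint : ∀ {n} → (Vect n → Set) → Vect n → Vect n → Set
  IsNearestPoint K d x = K x × (∀ y → K y → dist² d x ≤ dist² d y)

-- Write a_k for the value of the k-th merge (S_k, T_k) and D_k = S_k × T_k.
--  (1) x ∈ C_F: x equals a_k on D_k, and a_1 ≤ a_2 ≤ …, because after
--      merging a pair of minimal average every average involving S ∪ T is a
--      mediant of averages involving S and T, so the minimum cannot drop.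
--  (2) d - x ⊥ x - y for every y constant on each D_k (the order of the
--      values of y is not needed): the D_k partition the pairs {i, j}, and
--      on D_k the sum of d - a_k vanishes since a_k is the average of d there.
--  (3) Pythagoras: |d - y|² = |d - x|² + |x - y|² ≥ |d - x|².

module Submission where

open import Defs
open import Level using (0ℓ)
open import Function using (id)
open import Data.Nat as ℕ using (ℕ; zero; suc)
import Data.Nat.Properties as ℕP
open import Data.Nat.ListAction using () renaming (sum to sumℕ)
open import Data.Nat.ListAction.Properties using (sum-↭)
open import Data.Nat.Tactic.RingSolver using (solve-∀)
open import Data.Bool using (Bool; true; false; if_then_else_; _∨_; _∧_; T)
open import Data.Unit using (tt)
open import Data.Fin as Fin using (Fin; toℕ)
open import Data.Fin.Properties using (toℕ-injective)
open import Data.Fin.Subset using (Subset; ∣_∣; _∪_; ⁅_⁆; Nonempty)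
open import Data.Fin.Subset.Properties using (p⊆p∪q; x∈⁅x⁆; x∈⁅y⁆⇒x≡y)
open import Data.Vec using ([]; _∷_; lookup; there)
open import Data.Vec.Properties using (lookup-zipWith; lookup-replicate; lookup⇒[]=)
open import Data.List using (List; []; _∷_; map; tabulate; allFin; _++_)
open import Data.List.Properties using (map-tabulate)
open import Data.List.Relation.Unary.All as All using (All; []; _∷_)
open import Data.List.Relation.Unary.AllPairs using (AllPairs; []; _∷_)
open import Data.List.Relation.Unary.Linked using (Linked)
open import Data.List.Relation.Unary.Linked.Properties using (AllPairs⇒Linked)
open import Data.List.Relation.Binary.Pointwise using (Pointwise; []; _∷_)
open import Data.List.Relation.Unary.All.Properties using (tabulate⁺) renaming (map⁺ to All-map⁺)
open import Data.List.Relation.Unary.Any as Any using ()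
open import Data.List.Membership.Propositional.Properties using (∈-∃++)
open import Data.List.Relation.Binary.Permutation.Propositional
  using (_↭_; prep; swap) renaming (refl to ↭-refl; trans to ↭-trans)
open import Data.List.Relation.Binary.Permutation.Propositional.Properties
  using (All-resp-↭; ∈-resp-↭; drop-∷; shift; shifts) renaming (map⁺ to ↭-map⁺)
open import Data.Product using (_×_; _,_; proj₁; proj₂; ∃)
open import Data.Sum using (_⊎_; inj₁; inj₂)
open import Data.Empty using (⊥-elim)
open import Relation.Nullary using (¬_)
open import Relation.Binary.PropositionalEquality
open import Relation.Binary.Structures using (IsTotalOrder)
open import Algebra.Bundles using (CommutativeRing)
import Algebra.Properties.Ring as RingProperties
import Algebra.Properties.CommutativeSemigroup as CommutativeSemigroupProperties
import Algebra.Properties.Semiring.Sum as SemiringSum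
import Algebra.Properties.Semiring.Mult as SemiringMult

module OrderedFieldFacts (F : OrderedField) where
  open OrderedField F

  commutativeRing : CommutativeRing 0ℓ 0ℓ
  commutativeRing = record { isCommutativeRing = isCommutativeRing }

  open CommutativeRing commutativeRing public
    using ( +-assoc; +-comm; +-identityˡ; +-identityʳ; *-assoc; *-comm
          ; *-identityˡ; *-identityʳ; distribˡ; distribʳ; zeroˡ; zeroʳ
          ; -‿inverseˡ; -‿inverseʳ; ring; semiring; +-commutativeSemigroup )
  open CommutativeSemigroupProperties +-commutativeSemigroup using (interchange)
  open RingProperties ring public using (-‿distribˡ-*; -‿distribʳ-*; -‿involutive)
  open IsTotalOrder isTotalOrder public
    using (total; antisym) renaming (refl to ≤-refl; trans to ≤-trans)
  open ≡-Reasoning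

  Positive : Carrier → Set
  Positive a = 0# ≤ a × ¬ (a ≡ 0#)

  minus-plus : ∀ a b → (b - a) + a ≡ b
  minus-plus a b = begin
    (b + - a) + a  ≡⟨ +-assoc b (- a) a ⟩
    b + (- a + a)  ≡⟨ cong (b +_) (-‿inverseˡ a) ⟩
    b + 0#         ≡⟨ +-identityʳ b ⟩
    b              ∎

  sub-split : ∀ a b c → a - c ≡ (a - b) + (b - c)
  sub-split a b c = sym (begin
    (a + - b) + (b + - c)  ≡⟨ +-assoc a (- b) (b + - c) ⟩
    a + (- b + (b + - c))  ≡⟨ cong (a +_) (sym (+-assoc (- b) b (- c))) ⟩
    a + ((- b + b) + - c)  ≡⟨ cong (λ z → a + (z + - c)) (-‿inverseˡ b) ⟩
    a + (0# + - c)         ≡⟨ cong (a +_) (+-identityˡ (- c)) ⟩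
    a - c                  ∎)

  square-of-sum : ∀ u v → (u + v) * (u + v) ≡ (u * u + v * v) + (u * v + u * v)
  square-of-sum u v = begin
    (u + v) * (u + v)                  ≡⟨ distribˡ (u + v) u v ⟩
    (u + v) * u + (u + v) * v          ≡⟨ cong₂ _+_ (distribʳ u u v) (distribʳ v u v) ⟩
    (u * u + v * u) + (u * v + v * v)  ≡⟨ cong (λ z → (u * u + z) + (u * v + v * v)) (*-comm v u) ⟩
    (u * u + u * v) + (u * v + v * v)  ≡⟨ cong ((u * u + u * v) +_) (+-comm (u * v) (v * v)) ⟩
    (u * u + u * v) + (v * v + u * v)  ≡⟨ interchange (u * u) (u * v) (v * v) (u * v) ⟩
    (u * u + v * v) + (u * v + u * v)  ∎

  +-mono₂-≤ : ∀ {a b c e} → a ≤ b → c ≤ e → a + c ≤ b + e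
  +-mono₂-≤ {a} {b} {c} {e} a≤b c≤e = ≤-trans (+-mono-≤ a b c a≤b)
    (subst₂ _≤_ (+-comm c b) (+-comm e b) (+-mono-≤ c e b c≤e))

  +-nonneg : ∀ {a b} → 0# ≤ a → 0# ≤ b → 0# ≤ a + b
  +-nonneg 0≤a 0≤b = subst (_≤ _) (+-identityˡ 0#) (+-mono₂-≤ 0≤a 0≤b)

  ≤⇒0≤- : ∀ {a b} → a ≤ b → 0# ≤ b - a
  ≤⇒0≤- {a} {b} a≤b = subst (_≤ b - a) (-‿inverseʳ a) (+-mono-≤ a b (- a) a≤b)

  0≤-⇒≤ : ∀ {a b} → 0# ≤ b - a → a ≤ b
  0≤-⇒≤ {a} {b} 0≤b-a = subst₂ _≤_ (+-identityˡ a) (minus-plus a b) (+-mono-≤ 0# (b - a) a 0≤b-a)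

  *-monoʳ-≤ : ∀ {a b} c → 0# ≤ c → a ≤ b → a * c ≤ b * c
  *-monoʳ-≤ {a} {b} c 0≤c a≤b = 0≤-⇒≤ (subst (0# ≤_) distrib (*-nonneg (b - a) c (≤⇒0≤- a≤b) 0≤c))
    where
    distrib : (b - a) * c ≡ b * c - a * c
    distrib = trans (distribʳ c b (- a)) (cong (b * c +_) (sym (-‿distribˡ-* a c)))

  neg-nonneg : ∀ {a} → a ≤ 0# → 0# ≤ - a
  neg-nonneg {a} a≤0 = subst₂ _≤_ (-‿inverseʳ a) (+-identityˡ (- a)) (+-mono-≤ a 0# (- a) a≤0)

  square-nonneg : ∀ a → 0# ≤ a * a
  square-nonneg a with total 0# a
  ... | inj₁ 0≤a = *-nonneg a a 0≤a 0≤a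
  ... | inj₂ a≤0 = subst (0# ≤_) neg-square (*-nonneg (- a) (- a) (neg-nonneg a≤0) (neg-nonneg a≤0))
    where
    neg-square : - a * - a ≡ a * a
    neg-square = begin
      - a * - a    ≡⟨ sym (-‿distribˡ-* a (- a)) ⟩
      - (a * - a)  ≡⟨ cong -_ (sym (-‿distribʳ-* a a)) ⟩
      - - (a * a)  ≡⟨ -‿involutive (a * a) ⟩
      a * a        ∎

  0≤1 : 0# ≤ 1#
  0≤1 = subst (0# ≤_) (*-identityˡ 1#) (square-nonneg 1#)

  -- the inverse of a positive element is non-negative (else 1 = a·a⁻¹ ≤ 0)
  inverse-nonneg : ∀ {a} → Positive a → 0# ≤ a ⁻¹
  inverse-nonneg {a} (0≤a , a≢0) with total 0# (a ⁻¹)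
  ... | inj₁ 0≤a⁻¹ = 0≤a⁻¹
  ... | inj₂ a⁻¹≤0 = ⊥-elim (0≢1 (antisym 0≤1 1≤0))
    where
    1≤0 : 1# ≤ 0#
    1≤0 = 0≤-⇒≤ (subst (0# ≤_) eq (*-nonneg a (- (a ⁻¹)) 0≤a (neg-nonneg a⁻¹≤0)))
      where
      eq : a * - (a ⁻¹) ≡ 0# - 1#
      eq = begin
        a * - (a ⁻¹)   ≡⟨ sym (-‿distribʳ-* a (a ⁻¹)) ⟩
        - (a * a ⁻¹)   ≡⟨ cong -_ (⁻¹-inverse a a≢0) ⟩
        - 1#           ≡⟨ sym (+-identityˡ (- 1#)) ⟩
        0# - 1#        ∎

  cancel-inverse : ∀ A {a} → ¬ (a ≡ 0#) → A * a ⁻¹ * a ≡ A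
  cancel-inverse A {a} a≢0 = begin
    A * a ⁻¹ * a    ≡⟨ *-assoc A (a ⁻¹) a ⟩
    A * (a ⁻¹ * a)  ≡⟨ cong (A *_) (trans (*-comm (a ⁻¹) a) (⁻¹-inverse a a≢0)) ⟩
    A * 1#          ≡⟨ *-identityʳ A ⟩
    A               ∎

  ≤-div⇒*-≤ : ∀ {m A a} → Positive a → m ≤ A * a ⁻¹ → m * a ≤ A
  ≤-div⇒*-≤ {m} {A} {a} (0≤a , a≢0) m≤A/a =
    subst (m * a ≤_) (cancel-inverse A a≢0) (*-monoʳ-≤ a 0≤a m≤A/a)

  *-≤⇒≤-div : ∀ {m A a} → Positive a → m * a ≤ A → m ≤ A * a ⁻¹
  *-≤⇒≤-div {m} {A} {a} a>0@(_ , a≢0) ma≤A =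
    subst (_≤ A * a ⁻¹) cancel (*-monoʳ-≤ (a ⁻¹) (inverse-nonneg a>0) ma≤A)
    where
    cancel : m * a * a ⁻¹ ≡ m
    cancel = trans (*-assoc m a (a ⁻¹)) (trans (cong (m *_) (⁻¹-inverse a a≢0)) (*-identityʳ m))

  positive-+ : ∀ {a b} → Positive a → 0# ≤ b → Positive (a + b)
  positive-+ {a} {b} (0≤a , a≢0) 0≤b =
    +-nonneg 0≤a 0≤b ,
    λ a+b≡0 → a≢0 (antisym (subst₂ _≤_ (+-identityʳ a) a+b≡0 (+-mono₂-≤ (≤-refl {a}) 0≤b)) 0≤a)

  mediant : ∀ {m A B a b} → Positive a → Positive b →
            m ≤ A * a ⁻¹ → m ≤ B * b ⁻¹ → m ≤ (A + B) * (a + b) ⁻¹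
  mediant {m} {A} {B} {a} {b} a>0 b>0 m≤A/a m≤B/b =
    *-≤⇒≤-div (positive-+ a>0 (proj₁ b>0))
      (subst (_≤ A + B) (sym (distribˡ m a b))
        (+-mono₂-≤ (≤-div⇒*-≤ a>0 m≤A/a) (≤-div⇒*-≤ b>0 m≤B/b)))

ι : Bool → ℕ
ι true  = 1
ι false = 0

ι+0≡1⇒true : ∀ {b} → ι b ℕ.+ 0 ≡ 1 → b ≡ true
ι+0≡1⇒true {true} _ = refl

sum-tabulate-zero : ∀ {m} {f : Fin m → ℕ} → (∀ k → f k ≡ 0) → sumℕ (tabulate f) ≡ 0
sum-tabulate-zero {zero}  f≡0 = refl
sum-tabulate-zero {suc m} f≡0 = cong₂ ℕ._+_ (f≡0 Fin.zero) (sum-tabulate-zero (λ k → f≡0 (Fin.suc k)))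

count-singleton : ∀ {m} (i : Fin m) → sumℕ (tabulate (λ k → ι (lookup ⁅ k ⁆ i))) ≡ 1
count-singleton {suc m} Fin.zero    = cong suc (sum-tabulate-zero {m} (λ k → refl))
count-singleton {suc m} (Fin.suc i) =
  cong₂ ℕ._+_ (cong ι (lookup-replicate i false)) (count-singleton i)

head-position : ∀ {A : Set} {U S' T' : A} {Q Q'} → (U ∷ Q) ↭ (S' ∷ T' ∷ Q') →
  (S' ≡ U × Q ↭ T' ∷ Q') ⊎ (T' ≡ U × Q ↭ S' ∷ Q') ⊎ (∃ λ R → Q ↭ S' ∷ T' ∷ R)
head-position {U = U} {S'} {T'} {Q} {Q'} p with ∈-resp-↭ p (Any.here refl)
... | Any.here refl         = inj₁ (refl , drop-∷ p)
... | Any.there (Any.here refl) = inj₂ (inj₁ (refl , drop-∷ (↭-trans p (swap S' U ↭-refl))))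
... | Any.there (Any.there U∈Q') with ∈-∃++ U∈Q'
...   | R₁ , R₂ , refl = inj₂ (inj₂ (R₁ ++ R₂ , drop-∷ (↭-trans p (shift U (S' ∷ T' ∷ R₁) R₂))))

module Partitions {n : ℕ} where
  open ≡-Reasoning

  count : List (Subset n) → Fin n → ℕ
  count P i = sumℕ (map (λ B → ι (lookup B i)) P)

  together : List (Subset n) → Fin n → Fin n → ℕ
  together P i j = sumℕ (map (λ B → ι (lookup B i ∧ lookup B j)) P)

  record IsPartition (P : List (Subset n)) : Set where
    field
      covered-once : ∀ i → count P i ≡ 1
      nonempty     : All Nonempty P
  open IsPartition public

  Disjoint : Subset n → Subset n → Set
  Disjoint S T = ∀ i → ¬ (lookup S i ≡ true × lookup T i ≡ true)

  sum-map-↭ : ∀ (w : Subset n → ℕ) {P P'} → P ↭ P' → sumℕ (map w P) ≡ sumℕ (map w P')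
  sum-map-↭ w P↭P' = sum-↭ (↭-map⁺ w P↭P')

  IsPartition-↭ : ∀ {P P'} → P ↭ P' → IsPartition P → IsPartition P'
  IsPartition-↭ P↭P' part = record
    { covered-once = λ i → trans (sym (sum-map-↭ (λ B → ι (lookup B i)) P↭P')) (covered-once part i)
    ; nonempty     = All-resp-↭ P↭P' (nonempty part)
    }

  -- distinct blocks of a partition are disjoint (else i would be counted twice)
  heads-disjoint : ∀ {S T Q} → IsPartition (S ∷ T ∷ Q) → Disjoint S T
  heads-disjoint {S} {T} {Q} part i (i∈S , i∈T)
    with () ← subst₂ (λ a b → ι a ℕ.+ (ι b ℕ.+ count Q i) ≡ 1) i∈S i∈T (covered-once part i)

  ι-∨ : ∀ {a b} → ¬ (a ≡ true × b ≡ true) → ι (a ∨ b) ≡ ι a ℕ.+ ι b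
  ι-∨ {false} {b}     _    = refl
  ι-∨ {true}  {false} _    = refl
  ι-∨ {true}  {true}  excl = ⊥-elim (excl (refl , refl))

  IsPartition-merge : ∀ {S T Q} → IsPartition (S ∷ T ∷ Q) → IsPartition ((S ∪ T) ∷ Q)
  IsPartition-merge {S} {T} {Q} part@record { nonempty = (i , i∈S) ∷ _ ∷ neQ } = record
    { covered-once = once
    ; nonempty     = (i , p⊆p∪q T i∈S) ∷ neQ
    }
    where
    once : ∀ i → count ((S ∪ T) ∷ Q) i ≡ 1
    once i = begin
      ι (lookup (S ∪ T) i) ℕ.+ count Q i                ≡⟨ cong (λ b → ι b ℕ.+ count Q i) (lookup-zipWith _∨_ i S T) ⟩
      ι (lookup S i ∨ lookup T i) ℕ.+ count Q i         ≡⟨ cong (ℕ._+ count Q i) (ι-∨ (heads-disjoint part i)) ⟩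
      (ι (lookup S i) ℕ.+ ι (lookup T i)) ℕ.+ count Q i ≡⟨ ℕP.+-assoc (ι (lookup S i)) _ _ ⟩
      count (S ∷ T ∷ Q) i                               ≡⟨ covered-once part i ⟩
      1                                                 ∎

  sum-over-singletons : ∀ (w : Subset n → ℕ) → sumℕ (map w (map ⁅_⁆ (allFin n))) ≡ sumℕ (tabulate (λ k → w ⁅ k ⁆))
  sum-over-singletons w = cong sumℕ (trans (cong (map w) (map-tabulate id ⁅_⁆)) (map-tabulate ⁅_⁆ w))

  together-singletons : ∀ {i j} → ¬ (i ≡ j) → together (map ⁅_⁆ (allFin n)) i j ≡ 0
  together-singletons {i} {j} i≢j =
    trans (sum-over-singletons (λ B → ι (lookup B i ∧ lookup B j))) (sum-tabulate-zero apart)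
    where
    apart : ∀ k → ι (lookup ⁅ k ⁆ i ∧ lookup ⁅ k ⁆ j) ≡ 0
    apart k with lookup ⁅ k ⁆ i in k∋i | lookup ⁅ k ⁆ j in k∋j
    ... | false | _     = refl
    ... | true  | false = refl
    ... | true  | true  = ⊥-elim (i≢j (trans (x∈⁅y⁆⇒x≡y k (lookup⇒[]= i ⁅ k ⁆ k∋i))
                                          (sym (x∈⁅y⁆⇒x≡y k (lookup⇒[]= j ⁅ k ⁆ k∋j)))))

  IsPartition-singletons : IsPartition (map ⁅_⁆ (allFin n))
  IsPartition-singletons = record
    { covered-once = λ i → trans (sum-over-singletons (λ B → ι (lookup B i))) (count-singleton i)
    ; nonempty     = All-map⁺ (tabulate⁺ (λ i → i , x∈⁅x⁆ i))
    }

module BlockSums (F : OrderedField) where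
  open OrderedField F
  open UPGMA F
  open OrderedFieldFacts F
  open Partitions using (Disjoint)
  open SemiringSum semiring public
    using (sum; sum-cong-≗; ∑-distrib-+; ∑-comm; *-distribʳ-sum; sum-replicate-zero)
  open SemiringMult semiring public
    using (×-homo-+; ×-homo-1; ×-assocˡ) renaming (_×_ to _·_)
  open ≡-Reasoning

  when : Bool → Carrier → Carrier
  when b x = if b then x else 0#

  when-+ : ∀ b x y → when b (x + y) ≡ when b x + when b y
  when-+ false x y = sym (+-identityˡ 0#)
  when-+ true  x y = refl

  when-0 : ∀ b → when b 0# ≡ 0#
  when-0 false = refl
  when-0 true  = refl

  when-*ʳ : ∀ b x c → when b (x * c) ≡ when b x * c
  when-*ʳ false x c = sym (zeroˡ c)
  when-*ʳ true  x c = refl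

  when-nonneg : ∀ b {x} → 0# ≤ x → 0# ≤ when b x
  when-nonneg false 0≤x = ≤-refl
  when-nonneg true  0≤x = 0≤x

  when-comm : ∀ a b x → when a (when b x) ≡ when b (when a x)
  when-comm false false x = refl
  when-comm false true  x = refl
  when-comm true  false x = refl
  when-comm true  true  x = refl

  when-∨ : ∀ {a b} x → ¬ (a ≡ true × b ≡ true) → when (a ∨ b) x ≡ when a x + when b x
  when-∨ {false} {false} x _ = sym (+-identityˡ 0#)
  when-∨ {false} {true}  x _ = sym (+-identityˡ x)
  when-∨ {true}  {false} x _ = sym (+-identityʳ x)
  when-∨ {true}  {true}  x excl = ⊥-elim (excl (refl , refl))

  sum-when : ∀ {n} b (f : Fin n → Carrier) → sum (λ i → when b (f i)) ≡ when b (sum f)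
  sum-when {n} false f = sum-replicate-zero n
  sum-when     true  f = refl

  sum-nonneg : ∀ {n} (f : Fin n → Carrier) → (∀ i → 0# ≤ f i) → 0# ≤ sum f
  sum-nonneg {zero}  f 0≤f = ≤-refl
  sum-nonneg {suc n} f 0≤f = +-nonneg (0≤f Fin.zero) (sum-nonneg (λ i → f (Fin.suc i)) (λ i → 0≤f (Fin.suc i)))

  sumFin≡sum : ∀ {n} (f : Fin n → Carrier) → sumFin f ≡ sum f
  sumFin≡sum {zero}  f = refl
  sumFin≡sum {suc n} f = cong (f Fin.zero +_) (sumFin≡sum (λ i → f (Fin.suc i)))

  fromℕ≡·1 : ∀ k → fromℕ k ≡ k · 1#
  fromℕ≡·1 zero    = refl
  fromℕ≡·1 (suc k) = cong (1# +_) (fromℕ≡·1 k)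

  ∑∑ : ∀ {n} → Vect n → Carrier
  ∑∑ g = sum (λ i → sum (λ j → g i j))

  sumFin²≡∑∑ : ∀ {n} (g : Vect n) → sumFin (λ i → sumFin (λ j → g i j)) ≡ ∑∑ g
  sumFin²≡∑∑ g = trans (sumFin≡sum (λ i → sumFin (g i))) (sum-cong-≗ (λ i → sumFin≡sum (g i)))

  ∑∑-cong : ∀ {n} {g h : Vect n} → (∀ i j → g i j ≡ h i j) → ∑∑ g ≡ ∑∑ h
  ∑∑-cong g≡h = sum-cong-≗ (λ i → sum-cong-≗ (g≡h i))

  ∑∑-+ : ∀ {n} (g h : Vect n) → ∑∑ (λ i j → g i j + h i j) ≡ ∑∑ g + ∑∑ h
  ∑∑-+ g h = trans (sum-cong-≗ (λ i → ∑-distrib-+ (g i) (h i))) (∑-distrib-+ (λ i → sum (g i)) (λ i → sum (h i)))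

  ∑∑-*ʳ : ∀ {n} (g : Vect n) c → ∑∑ (λ i j → g i j * c) ≡ ∑∑ g * c
  ∑∑-*ʳ g c = sym (trans (*-distribʳ-sum c (λ i → sum (g i))) (sum-cong-≗ (λ i → *-distribʳ-sum c (g i))))

  ∑∑-transpose : ∀ {n} (g : Vect n) → ∑∑ (λ i j → g j i) ≡ ∑∑ g
  ∑∑-transpose g = sym (∑-comm g)

  ∑∑-zero : ∀ {n} → ∑∑ {n} (λ _ _ → 0#) ≡ 0#
  ∑∑-zero {n} = begin
    ∑∑ {n} (λ _ _ → 0#)         ≡⟨ sum-cong-≗ {n} (λ _ → sum-replicate-zero n) ⟩
    sum {n} (λ _ → 0#)          ≡⟨ sum-replicate-zero n ⟩
    0#                          ∎

  ∑∑-nonneg : ∀ {n} (g : Vect n) → (∀ i j → 0# ≤ g i j) → 0# ≤ ∑∑ g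
  ∑∑-nonneg g 0≤g = sum-nonneg _ (λ i → sum-nonneg (g i) (0≤g i))

  restrict : ∀ {n} → Vect n → Subset n → Subset n → Vect n
  restrict g S T i j = when (lookup S i) (when (lookup T j) (g i j))

  blockSum : ∀ {n} → Vect n → Subset n → Subset n → Carrier
  blockSum g S T = ∑∑ (restrict g S T)

  one : ∀ {n} → Vect n
  one _ _ = 1#

  blockSum-cong : ∀ {n} {g h : Vect n} S T → (∀ i j → g i j ≡ h i j) → blockSum g S T ≡ blockSum h S T
  blockSum-cong S T g≡h = ∑∑-cong (λ i j → cong (λ z → when (lookup S i) (when (lookup T j) z)) (g≡h i j))

  blockSum-+ : ∀ {n} (g h : Vect n) S T →
               blockSum (λ i j → g i j + h i j) S T ≡ blockSum g S T + blockSum h S T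
  blockSum-+ g h S T = trans (∑∑-cong split) (∑∑-+ (restrict g S T) (restrict h S T))
    where
    split : ∀ i j → restrict (λ i j → g i j + h i j) S T i j ≡ restrict g S T i j + restrict h S T i j
    split i j = trans (cong (when (lookup S i)) (when-+ (lookup T j) (g i j) (h i j))) (when-+ (lookup S i) _ _)

  blockSum-*ʳ : ∀ {n} (g : Vect n) c S T → blockSum (λ i j → g i j * c) S T ≡ blockSum g S T * c
  blockSum-*ʳ g c S T = trans (∑∑-cong pull) (∑∑-*ʳ (restrict g S T) c)
    where
    pull : ∀ i j → restrict (λ i j → g i j * c) S T i j ≡ restrict g S T i j * c
    pull i j = trans (cong (when (lookup S i)) (when-*ʳ (lookup T j) (g i j) c)) (when-*ʳ (lookup S i) _ c)

  blockSum-const : ∀ {n} c (S T : Subset n) → blockSum (λ _ _ → c) S T ≡ blockSum one S T * c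
  blockSum-const c S T = trans (blockSum-cong S T (λ _ _ → sym (*-identityˡ c))) (blockSum-*ʳ one c S T)

  blockSum-rows : ∀ {n} (g : Vect n) S T →
    blockSum g S T ≡ sum (λ i → when (lookup S i) (sum (λ j → when (lookup T j) (g i j))))
  blockSum-rows g S T = sum-cong-≗ (λ i → sum-when (lookup S i) (λ j → when (lookup T j) (g i j)))

  blockSum-transpose : ∀ {n} (g : Vect n) → Symmetric g → ∀ S T → blockSum g T S ≡ blockSum g S T
  blockSum-transpose g g-sym S T = trans (∑∑-cong transposed) (∑∑-transpose (restrict g S T))
    where
    transposed : ∀ i j → when (lookup T i) (when (lookup S j) (g i j)) ≡ when (lookup S j) (when (lookup T i) (g j i))
    transposed i j = trans (when-comm (lookup T i) (lookup S j) (g i j))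
                     (cong (λ z → when (lookup S j) (when (lookup T i) z)) (g-sym i j))

  blockSum-∪ : ∀ {n} (g : Vect n) S T U → Disjoint S T →
               blockSum g (S ∪ T) U ≡ blockSum g S U + blockSum g T U
  blockSum-∪ {n} g S T U disjoint = begin
    blockSum g (S ∪ T) U                                                ≡⟨ blockSum-rows g (S ∪ T) U ⟩
    sum (λ i → when (lookup (S ∪ T) i) (row i))                         ≡⟨ sum-cong-≗ split ⟩
    sum (λ i → when (lookup S i) (row i) + when (lookup T i) (row i))
      ≡⟨ ∑-distrib-+ (λ i → when (lookup S i) (row i)) (λ i → when (lookup T i) (row i)) ⟩
    sum (λ i → when (lookup S i) (row i)) + sum (λ i → when (lookup T i) (row i))
      ≡⟨ sym (cong₂ _+_ (blockSum-rows g S U) (blockSum-rows g T U)) ⟩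
    blockSum g S U + blockSum g T U                                     ∎
    where
    row : Fin n → Carrier
    row i = sum (λ j → when (lookup U j) (g i j))
    split : ∀ i → when (lookup (S ∪ T) i) (row i) ≡ when (lookup S i) (row i) + when (lookup T i) (row i)
    split i = trans (cong (λ b → when b (row i)) (lookup-zipWith _∨_ i S T)) (when-∨ (row i) (disjoint i))

  count-when : ∀ {n} (S : Subset n) c → sum (λ i → when (lookup S i) c) ≡ ∣ S ∣ · c
  count-when []          c = refl
  count-when (true  ∷ S) c = cong (c +_) (count-when S c)
  count-when (false ∷ S) c = trans (+-identityˡ _) (count-when S c)

  blockSum-one : ∀ {n} (S T : Subset n) → blockSum one S T ≡ (∣ S ∣ ℕ.* ∣ T ∣) · 1#
  blockSum-one S T = begin
    blockSum one S T                                    ≡⟨ blockSum-rows one S T ⟩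
    sum (λ i → when (lookup S i) (sum (λ j → when (lookup T j) 1#)))
      ≡⟨ sum-cong-≗ (λ i → cong (when (lookup S i)) (count-when T 1#)) ⟩
    sum (λ i → when (lookup S i) (∣ T ∣ · 1#))          ≡⟨ count-when S _ ⟩
    ∣ S ∣ · (∣ T ∣ · 1#)                                ≡⟨ ×-assocˡ 1# ∣ S ∣ ∣ T ∣ ⟩
    (∣ S ∣ ℕ.* ∣ T ∣) · 1#                              ∎

  nonempty-size : ∀ {n} {S : Subset n} → Nonempty S → ∃ λ k → ∣ S ∣ ≡ suc k
  nonempty-size {S = true ∷ S}  _                    = ∣ S ∣ , refl
  nonempty-size {S = false ∷ S} (Fin.suc i , there i∈S) = nonempty-size (i , i∈S)

  ·1-nonneg : ∀ k → 0# ≤ k · 1#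
  ·1-nonneg zero    = ≤-refl
  ·1-nonneg (suc k) = +-nonneg 0≤1 (·1-nonneg k)

  ·1-positive : ∀ k → Positive (suc k · 1#)
  ·1-positive k = positive-+ (0≤1 , λ 1≡0 → 0≢1 (sym 1≡0)) (·1-nonneg k)

  blockSum-one-positive : ∀ {n} {S T : Subset n} → Nonempty S → Nonempty T → Positive (blockSum one S T)
  blockSum-one-positive {S = S} {T} neS neT with nonempty-size neS | nonempty-size neT
  ... | k , ∣S∣≡1+k | l , ∣T∣≡1+l
    rewrite blockSum-one S T | ∣S∣≡1+k | ∣T∣≡1+l = ·1-positive (l ℕ.+ k ℕ.* suc l)

  avg≡ : ∀ {n} (d : Vect n) S T → avg d S T ≡ blockSum d S T * (blockSum one S T) ⁻¹
  avg≡ d S T = cong₂ (λ A a → A * a ⁻¹) (sumFin²≡∑∑ (restrict d S T))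
                     (trans (fromℕ≡·1 (∣ S ∣ ℕ.* ∣ T ∣)) (sym (blockSum-one S T)))

  avg-sym : ∀ {n} (d : Vect n) → Symmetric d → ∀ S T → avg d T S ≡ avg d S T
  avg-sym d d-sym S T = begin
    avg d T S                                 ≡⟨ avg≡ d T S ⟩
    blockSum d T S * (blockSum one T S) ⁻¹
      ≡⟨ cong₂ (λ A a → A * a ⁻¹) (blockSum-transpose d d-sym S T) (blockSum-transpose one (λ _ _ → refl) S T) ⟩
    blockSum d S T * (blockSum one S T) ⁻¹    ≡⟨ sym (avg≡ d S T) ⟩
    avg d S T                                 ∎

  avg-∪ : ∀ {n} (d : Vect n) {m} {S T U} → Disjoint S T → Nonempty S → Nonempty T → Nonempty U →
          m ≤ avg d S U → m ≤ avg d T U → m ≤ avg d (S ∪ T) U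
  avg-∪ d {m} {S} {T} {U} disjoint neS neT neU m≤SU m≤TU =
    subst (m ≤_) (sym avg-of-union)
      (mediant (blockSum-one-positive neS neU) (blockSum-one-positive neT neU)
               (subst (m ≤_) (avg≡ d S U) m≤SU) (subst (m ≤_) (avg≡ d T U) m≤TU))
    where
    avg-of-union : avg d (S ∪ T) U ≡ (blockSum d S U + blockSum d T U) * (blockSum one S U + blockSum one T U) ⁻¹
    avg-of-union = trans (avg≡ d (S ∪ T) U)
      (cong₂ (λ A a → A * a ⁻¹) (blockSum-∪ d S T U disjoint) (blockSum-∪ one S T U disjoint))

  blockSum-centred : ∀ {n} (d : Vect n) {S T} → Nonempty S → Nonempty T →
                     blockSum (λ i j → d i j - avg d S T) S T ≡ 0#
  blockSum-centred d {S} {T} neS neT = begin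
    blockSum (λ i j → d i j - a) S T          ≡⟨ blockSum-+ d (λ _ _ → - a) S T ⟩
    W + blockSum (λ _ _ → - a) S T            ≡⟨ cong (W +_) (blockSum-const (- a) S T) ⟩
    W + N * - a                               ≡⟨ cong (W +_) (sym (-‿distribʳ-* N a)) ⟩
    W + - (N * a)                             ≡⟨ cong (λ z → W + - z) N*avg≡W ⟩
    W + - W                                   ≡⟨ -‿inverseʳ W ⟩
    0#                                        ∎
    where
    a W N : Carrier
    a = avg d S T
    W = blockSum d S T
    N = blockSum one S T
    N*avg≡W : N * a ≡ W
    N*avg≡W = begin
      N * a              ≡⟨ cong (N *_) (avg≡ d S T) ⟩
      N * (W * N ⁻¹)     ≡⟨ *-comm N _ ⟩
      W * N ⁻¹ * N       ≡⟨ cancel-inverse W (proj₂ (blockSum-one-positive neS neT)) ⟩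
      W                  ∎

-- For disjoint blocks S, T and a = i ∈ S, b = i ∈ T, c = j ∈ S, e = j ∈ T:
-- i, j lie in S ∪ T together iff they lie together in S or in T, or the
-- merge of S and T separates them (in one of the two orientations).
merge-count : ∀ a b c e → ¬ (a ≡ true × b ≡ true) → ¬ (c ≡ true × e ≡ true) →
  (ι (a ∧ c) ℕ.+ ι (b ∧ e)) ℕ.+ (ι (a ∧ e) ℕ.+ ι (b ∧ c)) ≡ ι ((a ∨ b) ∧ (c ∨ e))
merge-count true  true  _     _     ab _  = ⊥-elim (ab (refl , refl))
merge-count _     _     true  true  _  ce = ⊥-elim (ce (refl , refl))
merge-count false false _     _     _  _  = refl
merge-count true  false false false _  _  = refl
merge-count true  false false true  _  _  = refl
merge-count true  false true  false _  _  = refl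
merge-count false true  false false _  _  = refl
merge-count false true  false true  _  _  = refl
merge-count false true  true  false _  _  = refl

module Runs (F : OrderedField) {n : ℕ} (d : UPGMA.Vect F n) (d-sym : UPGMA.Symmetric F d) where
  open OrderedField F
  open UPGMA F
  open OrderedFieldFacts F
  open BlockSums F
  open Partitions
  open ≡-Reasoning

  LowerBound : Carrier → List (Subset n) → Set
  LowerBound m P = ∀ S T Q → P ↭ S ∷ T ∷ Q → m ≤ avg d S T

  merged-bound : ∀ {P S T Q U Q'} → Step d P S T Q → IsPartition P → Q ↭ U ∷ Q' →
                 avg d S T ≤ avg d (S ∪ T) U
  merged-bound {P} {S} {T} {Q} {U} {Q'} (P↭STQ , minimal) part Q↭UQ' =
    avg-∪ d (heads-disjoint (IsPartition-↭ P↭STQ part)) neS neT neU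
      (minimal S U (T ∷ Q') P↭SUTQ') (minimal T U (S ∷ Q') P↭TUSQ')
    where
    P↭SUTQ' : P ↭ S ∷ U ∷ T ∷ Q'
    P↭SUTQ' = ↭-trans P↭STQ (prep S (↭-trans (prep T Q↭UQ') (swap T U ↭-refl)))
    P↭TUSQ' : P ↭ T ∷ U ∷ S ∷ Q'
    P↭TUSQ' = ↭-trans P↭STQ (↭-trans (swap S T ↭-refl) (prep T (↭-trans (prep S Q↭UQ') (swap S U ↭-refl))))
    neS : Nonempty S
    neS = All.head (nonempty (IsPartition-↭ P↭SUTQ' part))
    neU : Nonempty U
    neU = All.head (All.tail (nonempty (IsPartition-↭ P↭SUTQ' part)))
    neT : Nonempty T
    neT = All.head (nonempty (IsPartition-↭ P↭TUSQ' part))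

  step-bound : ∀ {P S T Q} → Step d P S T Q → IsPartition P → LowerBound (avg d S T) ((S ∪ T) ∷ Q)
  step-bound {P} {S} {T} {Q} st@(P↭STQ , minimal) part S' T' Q' p with head-position p
  ... | inj₁ (refl , Q↭T'Q')       = merged-bound st part Q↭T'Q'
  ... | inj₂ (inj₁ (refl , Q↭S'Q')) =
    subst (avg d S T ≤_) (sym (avg-sym d d-sym (S ∪ T) S')) (merged-bound st part Q↭S'Q')
  ... | inj₂ (inj₂ (R , Q↭S'T'R))  = minimal S' T' (S ∷ T ∷ R)
    (↭-trans P↭STQ (↭-trans (prep S (prep T Q↭S'T'R)) (shifts (S ∷ T ∷ []) (S' ∷ T' ∷ []))))

  partition-after : ∀ {P S T Q} → Step d P S T Q → IsPartition P → IsPartition ((S ∪ T) ∷ Q)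
  partition-after (P↭STQ , _) part = IsPartition-merge (IsPartition-↭ P↭STQ part)

  values : List (Merge n) → List Carrier
  values = map (λ { (_ , _ , a) → a })

  output-constant : ∀ ms {x} → IsOutput ms x → Pointwise (ConstOn x) (chain ms) (values ms)
  output-constant []                 []                = []
  output-constant ((S , T , a) ∷ ms) (x-const ∷ out) = x-const ∷ output-constant ms out

  values-bounded : ∀ {P ms m} → Run d P ms → IsPartition P → LowerBound m P → All (m ≤_) (values ms)
  values-bounded (done _)                      part bound = []
  values-bounded (step {S = S} {T} {Q} st run) part bound =
    bound S T Q (proj₁ st) ∷
    values-bounded run (partition-after st part)
      (λ S' T' Q' p → ≤-trans (bound S T Q (proj₁ st)) (step-bound st part S' T' Q' p))

  values-sorted : ∀ {P ms} → Run d P ms → IsPartition P → AllPairs _≤_ (values ms)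
  values-sorted (done _)      part = []
  values-sorted (step st run) part =
    values-bounded run (partition-after st part) (step-bound st part) ∷ values-sorted run (partition-after st part)

  ValidMerge : Merge n → Set
  ValidMerge (S , T , a) = Disjoint S T × Nonempty S × Nonempty T × a ≡ avg d S T

  merges-valid : ∀ {P ms} → Run d P ms → IsPartition P → All ValidMerge ms
  merges-valid (done _)       part = []
  merges-valid (step {S = S} {T} {Q} st run) part =
    (heads-disjoint part′ , All.head (nonempty part′) , All.head (All.tail (nonempty part′)) , refl) ∷
    merges-valid run (partition-after st part)
    where
    part′ : IsPartition (S ∷ T ∷ Q)
    part′ = IsPartition-↭ (proj₁ st) part

  separates : Subset n → Subset n → Fin n → Fin n → ℕ
  separates S T i j = ι (lookup S i ∧ lookup T j) ℕ.+ ι (lookup T i ∧ lookup S j)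

  separations : List (Merge n) → Fin n → Fin n → ℕ
  separations []                   i j = 0
  separations ((S , T , _) ∷ ms) i j = separates S T i j ℕ.+ separations ms i j

  together-or-separated : ∀ {P ms} → Run d P ms → IsPartition P → ∀ i j → together P i j ℕ.+ separations ms i j ≡ 1
  together-or-separated (done S) part i j
    rewrite ι+0≡1⇒true (covered-once part i) | ι+0≡1⇒true (covered-once part j) = refl
  together-or-separated {P} (step {S = S} {T} {Q} {ms} st run) part i j = begin
    together P i j ℕ.+ (separates S T i j ℕ.+ separations ms i j)
      ≡⟨ cong (ℕ._+ _) (sum-map-↭ (λ B → ι (lookup B i ∧ lookup B j)) (proj₁ st)) ⟩
    (ι (a ∧ c) ℕ.+ (ι (b ∧ e) ℕ.+ together Q i j)) ℕ.+ ((ι (a ∧ e) ℕ.+ ι (b ∧ c)) ℕ.+ separations ms i j)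
      ≡⟨ regroup (ι (a ∧ c)) (ι (b ∧ e)) (ι (a ∧ e) ℕ.+ ι (b ∧ c)) (together Q i j) (separations ms i j) ⟩
    ((ι (a ∧ c) ℕ.+ ι (b ∧ e)) ℕ.+ (ι (a ∧ e) ℕ.+ ι (b ∧ c)) ℕ.+ together Q i j) ℕ.+ separations ms i j
      ≡⟨ cong (λ k → (k ℕ.+ together Q i j) ℕ.+ separations ms i j)
              (merge-count a b c e (heads-disjoint part′ i) (heads-disjoint part′ j)) ⟩
    (ι ((a ∨ b) ∧ (c ∨ e)) ℕ.+ together Q i j) ℕ.+ separations ms i j
      ≡⟨ cong₂ (λ u v → (ι (u ∧ v) ℕ.+ together Q i j) ℕ.+ separations ms i j)
               (sym (lookup-zipWith _∨_ i S T)) (sym (lookup-zipWith _∨_ j S T)) ⟩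
    together ((S ∪ T) ∷ Q) i j ℕ.+ separations ms i j
      ≡⟨ together-or-separated run (partition-after st part) i j ⟩
    1 ∎
    where
    part′ : IsPartition (S ∷ T ∷ Q)
    part′ = IsPartition-↭ (proj₁ st) part
    a b c e : Bool
    a = lookup S i
    b = lookup T i
    c = lookup S j
    e = lookup T j
    regroup : ∀ p q r t s → (p ℕ.+ (q ℕ.+ t)) ℕ.+ (r ℕ.+ s) ≡ ((p ℕ.+ q) ℕ.+ r ℕ.+ t) ℕ.+ s
    regroup = solve-∀

  separated-once : ∀ {ms} → Run d (singletons n) ms → ∀ {i j} → ¬ (i ≡ j) → separations ms i j ≡ 1
  separated-once {ms} run {i} {j} i≢j =
    trans (cong (ℕ._+ separations ms i j) (sym (together-singletons i≢j)))
          (together-or-separated run IsPartition-singletons i j)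

module PairSums (F : OrderedField) {n : ℕ} where
  open OrderedField F
  open UPGMA F
  open OrderedFieldFacts F
  open BlockSums F
  open Partitions using (Disjoint)
  open ≡-Reasoning

  below : Fin n → Fin n → Bool
  below i j = toℕ i ℕ.<ᵇ toℕ j

  below⇒< : ∀ i j → below i j ≡ true → toℕ i ℕ.< toℕ j
  below⇒< i j i<j = ℕP.<ᵇ⇒< (toℕ i) (toℕ j) (subst T (sym i<j) tt)

  not-below⇒≥ : ∀ i j → below i j ≡ false → toℕ j ℕ.≤ toℕ i
  not-below⇒≥ i j i≮j = ℕP.≮⇒≥ (λ i<j → subst T i≮j (ℕP.<⇒<ᵇ i<j))

  below⇒≢ : ∀ {i j} → below i j ≡ true → ¬ (i ≡ j)
  below⇒≢ {i} i<i refl = ℕP.<-irrefl refl (below⇒< i i i<i)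

  below-split : ∀ {i j} → ¬ (i ≡ j) → ∀ e → when (below i j) e + when (below j i) e ≡ e
  below-split {i} {j} i≢j e with below i j in i<j | below j i in j<i
  ... | true  | true  = ⊥-elim (ℕP.<-asym (below⇒< i j i<j) (below⇒< j i j<i))
  ... | true  | false = +-identityʳ e
  ... | false | true  = +-identityˡ e
  ... | false | false = ⊥-elim (i≢j (toℕ-injective (ℕP.≤-antisym (not-below⇒≥ j i j<i) (not-below⇒≥ i j i<j))))

  pairSum : Vect n → Carrier
  pairSum g = ∑∑ (λ i j → when (below i j) (g i j))

  pairSum-cong : ∀ {g h : Vect n} → (∀ i j → below i j ≡ true → g i j ≡ h i j) → pairSum g ≡ pairSum h
  pairSum-cong {g} {h} g≡h = ∑∑-cong on-pairs
    where
    on-pairs : ∀ i j → when (below i j) (g i j) ≡ when (below i j) (h i j)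
    on-pairs i j with below i j in i<j
    ... | false = refl
    ... | true  = g≡h i j i<j

  pairSum-+ : ∀ (g h : Vect n) → pairSum (λ i j → g i j + h i j) ≡ pairSum g + pairSum h
  pairSum-+ g h = trans (∑∑-cong (λ i j → when-+ (below i j) (g i j) (h i j)))
                        (∑∑-+ (λ i j → when (below i j) (g i j)) (λ i j → when (below i j) (h i j)))

  pairSum-zero : pairSum (λ _ _ → 0#) ≡ 0#
  pairSum-zero = trans (∑∑-cong (λ i j → when-0 (below i j))) (∑∑-zero {n})

  pairSum-nonneg : ∀ (g : Vect n) → (∀ i j → 0# ≤ g i j) → 0# ≤ pairSum g
  pairSum-nonneg g 0≤g = ∑∑-nonneg _ (λ i j → when-nonneg (below i j) (0≤g i j))

  -- for symmetric g, the pairs of S × T and of T × S together make up S × T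
  pairSum-block : ∀ (g : Vect n) → Symmetric g → ∀ {S T} → Disjoint S T →
    pairSum (λ i j → restrict g S T i j + restrict g T S i j) ≡ blockSum g S T
  pairSum-block g g-sym {S} {T} disjoint = begin
    pairSum (λ i j → r i j + restrict g T S i j)
      ≡⟨ pairSum-+ r (restrict g T S) ⟩
    pairSum r + pairSum (restrict g T S)
      ≡⟨ cong (pairSum r +_) (sym (∑∑-transpose (λ i j → when (below i j) (restrict g T S i j)))) ⟩
    pairSum r + ∑∑ (λ i j → when (below j i) (restrict g T S j i))
      ≡⟨ cong (pairSum r +_) (∑∑-cong (λ i j → cong (when (below j i)) (transposed i j))) ⟩
    pairSum r + ∑∑ (λ i j → when (below j i) (r i j))
      ≡⟨ sym (∑∑-+ (λ i j → when (below i j) (r i j)) (λ i j → when (below j i) (r i j))) ⟩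
    ∑∑ (λ i j → when (below i j) (r i j) + when (below j i) (r i j))
      ≡⟨ ∑∑-cong both-orders ⟩
    blockSum g S T ∎
    where
    r : Vect n
    r = restrict g S T
    transposed : ∀ i j → restrict g T S j i ≡ r i j
    transposed i j = trans (when-comm (lookup T j) (lookup S i) (g j i))
                           (cong (λ z → when (lookup S i) (when (lookup T j) z)) (g-sym j i))
    both-orders : ∀ i j → when (below i j) (r i j) + when (below j i) (r i j) ≡ r i j
    both-orders i j with lookup S i in i∈S | lookup T j in j∈T
    ... | false | _     = trans (cong₂ _+_ (when-0 (below i j)) (when-0 (below j i))) (+-identityˡ 0#)
    ... | true  | false = trans (cong₂ _+_ (when-0 (below i j)) (when-0 (below j i))) (+-identityˡ 0#)
    ... | true  | true  = below-split {i} {j} (λ { refl → disjoint i (i∈S , j∈T) }) (g i j)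

  dist²≡pairSum : ∀ (u v : Vect n) → dist² u v ≡ pairSum (λ i j → (u i j - v i j) * (u i j - v i j))
  dist²≡pairSum u v = sumFin²≡∑∑ (λ i j → when (below i j) ((u i j - v i j) * (u i j - v i j)))

  pythagoras : ∀ (d x y : Vect n) → pairSum (λ i j → (d i j - x i j) * (x i j - y i j)) ≡ 0# →
               dist² d x ≤ dist² d y
  pythagoras d x y orthogonal = subst (dist² d x ≤_) (sym split) below-sum
    where
    u v uu vv uv : Vect n
    u i j = d i j - x i j
    v i j = x i j - y i j
    uu i j = u i j * u i j
    vv i j = v i j * v i j
    uv i j = u i j * v i j
    split : dist² d y ≡ dist² d x + dist² x y
    split = begin
      dist² d y
        ≡⟨ dist²≡pairSum d y ⟩
      pairSum (λ i j → (d i j - y i j) * (d i j - y i j))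
        ≡⟨ pairSum-cong (λ i j _ → trans (cong (λ z → z * z) (sub-split (d i j) (x i j) (y i j)))
                                         (square-of-sum (u i j) (v i j))) ⟩
      pairSum (λ i j → (uu i j + vv i j) + (uv i j + uv i j))
        ≡⟨ pairSum-+ (λ i j → uu i j + vv i j) (λ i j → uv i j + uv i j) ⟩
      pairSum (λ i j → uu i j + vv i j) + pairSum (λ i j → uv i j + uv i j)
        ≡⟨ cong₂ _+_ (pairSum-+ uu vv) (pairSum-+ uv uv) ⟩
      (pairSum uu + pairSum vv) + (pairSum uv + pairSum uv)
        ≡⟨ cong (λ z → (pairSum uu + pairSum vv) + (z + z)) orthogonal ⟩
      (pairSum uu + pairSum vv) + (0# + 0#)
        ≡⟨ trans (cong ((pairSum uu + pairSum vv) +_) (+-identityˡ 0#)) (+-identityʳ _) ⟩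
      pairSum uu + pairSum vv
        ≡⟨ sym (cong₂ _+_ (dist²≡pairSum d x) (dist²≡pairSum x y)) ⟩
      dist² d x + dist² x y ∎
    below-sum : dist² d x ≤ dist² d x + dist² x y
    below-sum = subst (_≤ dist² d x + dist² x y) (+-identityʳ (dist² d x))
      (+-mono₂-≤ (≤-refl {dist² d x})
        (subst (0# ≤_) (sym (dist²≡pairSum x y)) (pairSum-nonneg vv (λ i j → square-nonneg (v i j)))))

-- The residual d - x of the UPGMA output is orthogonal to every vector
-- constant on the blocks D_k of the chain: pair by pair, each D_k is the
-- set of pairs separated by the k-th merge, on which x - y is constant and
-- d - x has block sum zero.
module Orthogonality (F : OrderedField) {n : ℕ} (d : UPGMA.Vect F n) (d-sym : UPGMA.Symmetric F d) where
  open OrderedField F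
  open UPGMA F
  open OrderedFieldFacts F
  open BlockSums F
  open Partitions using (IsPartition-singletons)
  open Runs F d d-sym
  open PairSums F {n}
  open ≡-Reasoning

  cross : Vect n → Vect n → Vect n
  cross x y i j = (d i j - x i j) * (x i j - y i j)

  ι∧-· : ∀ p q x → ι (p ∧ q) · x ≡ when p (when q x)
  ι∧-· true  true  x = +-identityʳ x
  ι∧-· true  false x = refl
  ι∧-· false q     x = refl

  when-support : ∀ p q {u v} → (p ≡ true → q ≡ true → u ≡ v) → when p (when q u) ≡ when p (when q v)
  when-support true  true  u≡v = u≡v refl refl
  when-support true  false u≡v = refl
  when-support false q     u≡v = refl

  -- on the pairs separated by a merge at value a, where y takes the value c,
  -- the cross term sums to (Σ_{S×T} (d - a)) (a - c) = 0
  merge-orthogonal : ∀ {x y S T a c} → ConstOn x (S , T) a → ConstOn y (S , T) c → ValidMerge (S , T , a) →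
                     pairSum (λ i j → separates S T i j · cross x y i j) ≡ 0#
  merge-orthogonal {x} {y} {S} {T} {a} {c} x-const y-const (disjoint , neS , neT , a≡avg) = begin
    pairSum (λ i j → separates S T i j · cross x y i j)
      ≡⟨ pairSum-cong (λ i j _ → on-separated i j) ⟩
    pairSum (λ i j → restrict g S T i j + restrict g T S i j)
      ≡⟨ pairSum-block g (λ i j → cong (λ z → (z - a) * (a - c)) (d-sym i j)) {S} {T} disjoint ⟩
    blockSum g S T
      ≡⟨ blockSum-*ʳ (λ i j → d i j - a) (a - c) S T ⟩
    blockSum (λ i j → d i j - a) S T * (a - c)
      ≡⟨ cong (λ z → blockSum (λ i j → d i j - z) S T * (a - c)) a≡avg ⟩
    blockSum (λ i j → d i j - avg d S T) S T * (a - c)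
      ≡⟨ cong (_* (a - c)) (blockSum-centred d neS neT) ⟩
    0# * (a - c)
      ≡⟨ zeroˡ (a - c) ⟩
    0# ∎
    where
    g : Vect n
    g i j = (d i j - a) * (a - c)
    at : ∀ {i j} → x i j ≡ a → y i j ≡ c → cross x y i j ≡ g i j
    at {i} {j} = cong₂ (λ u w → (d i j - u) * (u - w))
    on-separated : ∀ i j → separates S T i j · cross x y i j ≡ restrict g S T i j + restrict g T S i j
    on-separated i j = begin
      separates S T i j · cross x y i j
        ≡⟨ ×-homo-+ (cross x y i j) (ι (lookup S i ∧ lookup T j)) (ι (lookup T i ∧ lookup S j)) ⟩
      ι (lookup S i ∧ lookup T j) · cross x y i j + ι (lookup T i ∧ lookup S j) · cross x y i j
        ≡⟨ cong₂ _+_ (ι∧-· (lookup S i) (lookup T j) _) (ι∧-· (lookup T i) (lookup S j) _) ⟩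
      restrict (cross x y) S T i j + restrict (cross x y) T S i j
        ≡⟨ cong₂ _+_ (when-support (lookup S i) (lookup T j) forward) (when-support (lookup T i) (lookup S j) backward) ⟩
      restrict g S T i j + restrict g T S i j ∎
      where
      forward : lookup S i ≡ true → lookup T j ≡ true → cross x y i j ≡ g i j
      forward i∈S j∈T = at (proj₁ (x-const i j (lookup⇒[]= i S i∈S) (lookup⇒[]= j T j∈T)))
                           (proj₁ (y-const i j (lookup⇒[]= i S i∈S) (lookup⇒[]= j T j∈T)))
      backward : lookup T i ≡ true → lookup S j ≡ true → cross x y i j ≡ g i j
      backward i∈T j∈S = at (proj₂ (x-const j i (lookup⇒[]= j S j∈S) (lookup⇒[]= i T i∈T)))
                            (proj₂ (y-const j i (lookup⇒[]= j S j∈S) (lookup⇒[]= i T i∈T)))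

  merges-orthogonal : ∀ ms {x y cs} → IsOutput ms x → Pointwise (ConstOn y) (chain ms) cs → All ValidMerge ms →
                      pairSum (λ i j → separations ms i j · cross x y i j) ≡ 0#
  merges-orthogonal []                 []              []             []          = pairSum-zero
  merges-orthogonal ((S , T , a) ∷ ms) {x} {y} (x-const ∷ out) (y-const ∷ ys) (valid ∷ vs) = begin
    pairSum (λ i j → (separates S T i j ℕ.+ separations ms i j) · cross x y i j)
      ≡⟨ pairSum-cong (λ i j _ → ×-homo-+ (cross x y i j) (separates S T i j) (separations ms i j)) ⟩
    pairSum (λ i j → separates S T i j · cross x y i j + separations ms i j · cross x y i j)
      ≡⟨ pairSum-+ (λ i j → separates S T i j · cross x y i j) (λ i j → separations ms i j · cross x y i j) ⟩
    pairSum (λ i j → separates S T i j · cross x y i j) + pairSum (λ i j → separations ms i j · cross x y i j)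
      ≡⟨ cong₂ _+_ (merge-orthogonal x-const y-const valid) (merges-orthogonal ms out ys vs) ⟩
    0# + 0#
      ≡⟨ +-identityˡ 0# ⟩
    0# ∎

  residual-orthogonal : ∀ {ms x y cs} → Run d (singletons n) ms → IsOutput ms x →
                        Pointwise (ConstOn y) (chain ms) cs → pairSum (cross x y) ≡ 0#
  residual-orthogonal {ms} {x} {y} run out y-const =
    trans (pairSum-cong once) (merges-orthogonal ms out y-const (merges-valid run IsPartition-singletons))
    where
    once : ∀ i j → below i j ≡ true → cross x y i j ≡ separations ms i j · cross x y i j
    once i j i<j = sym (trans (cong (_· cross x y i j) (separated-once run (below⇒≢ i<j))) (×-homo-1 (cross x y i j)))

proposition2p3 : (F : OrderedField) → let open UPGMA F in
    ∀ (n : ℕ) → 2 ℕ.≤ n → (d : Vect n) → Symmetric d →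
    (ms : List (Merge n)) → Run d (singletons n) ms →
    (x : Vect n) → IsOutput ms x →
    IsNearestPoint (InCone (chain ms)) d x
proposition2p3 F n _ d d-sym ms run x out = (values ms , output-constant ms out , increasing) , nearest
  where
  open OrderedField F using (_≤_)
  open UPGMA F
  open Runs F d d-sym
  open Orthogonality F d d-sym
  open PairSums F {n} using (pythagoras)

  increasing : Linked _≤_ (values ms)
  increasing = AllPairs⇒Linked (values-sorted run Partitions.IsPartition-singletons)

  nearest : ∀ y → InCone (chain ms) y → dist² d x ≤ dist² d y
  nearest y (_ , y-const , _) = pythagoras d x y (residual-orthogonal run out y-const)
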